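{- Let $G$ be a $\Delta$-regular finite loopless multigraph with $\omega(G)\le\Delta$. Then $\tau(G)=\Delta$.
   Context: All multigraphs are finite and loopless (parallel edges allowed). For a multigraph $G=(V,E)$, $\deg_G(x)$ is the degree of $x$; $G$ is $\Delta$-regular if every vertex has degree $\Delta$. For $S\subseteq V$, $E(S)$ denotes the multiset of edges with both endpoints in $S$. The density is $\omega(G)=\max_{H}\left\lceil \frac{e(H)}{\lfloor v(H)/2\rfloor}\right\rceil$, the maximum over sub-multigraphs $H\subseteq G$ with $v(H)\ge 2$ vertices, where $e(H)$ is the number of edges of $H$. A degree-coloring of $G$ with $c$ colors is a map $\mu: V\to 2^{\{1,\dots,c\}}$ such that (degree condition) $|\mu(x)|=\deg_G(x)$ for every $x\in V$, and (cover condition) for every $S\subseteq V$, $|E(S)|\le \sum_{i=1}^{c}\left\lfloor \frac{|S^{(i)}(\mu)|}{2}\right\rfloor$, where $S^{(i)}(\mu)=\{x\in S: i\in\mu(x)\}$. The degree-coloring index $\tau(G)$ is the smallest integer $c$ for which a degree-coloring of $G$ with $c$ colors exists. -}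

module Defs where

open import Data.Nat using (ℕ; zero; suc; _+_; _≤_)
open import Data.Nat.DivMod using (_/_)
open import Data.Bool using (Bool; true; false; _∧_; _∨_)
open import Data.Fin using (Fin; _≟_)
open import Data.Fin.Subset using (Subset; ∣_∣)
open import Data.Vec using (lookup; tabulate)
open import Data.List using (List; length; filterᵇ; map; allFin)
open import Data.Nat.ListAction using (sum)
open import Data.List.Relation.Unary.All using (All)
open import Data.List.Relation.Binary.Sublist.Propositional using (_⊆_)
open import Data.Product using (_×_; proj₁; proj₂; Σ)
open import Relation.Nullary using (¬_; does)
open import Relation.Binary.PropositionalEquality using (_≡_; _≢_)

Edge : ℕ → Set
Edge n = Fin n × Fin n

-- A finite loopless multigraph on vertex set Fin n; the edge multiset is a list
-- (parallel edges = repeated entries, in either orientation).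
record Multigraph (n : ℕ) : Set where
  field
    edges    : List (Edge n)
    loopless : All (λ e → proj₁ e ≢ proj₂ e) edges
open Multigraph public

incident : ∀ {n} → Fin n → Edge n → Bool
incident x e = does (x ≟ proj₁ e) ∨ does (x ≟ proj₂ e)

deg : ∀ {n} → Multigraph n → Fin n → ℕ
deg G x = length (filterᵇ (incident x) (edges G))

insideᵇ : ∀ {n} → Subset n → Edge n → Bool
insideᵇ S e = lookup S (proj₁ e) ∧ lookup S (proj₂ e)

eIn : ∀ {n} → Multigraph n → Subset n → ℕ
eIn G S = length (filterᵇ (insideᵇ S) (edges G))

Regular : ∀ {n} → Multigraph n → ℕ → Set
Regular G Δ = ∀ x → deg G x ≡ Δ

-- ceiling division ⌈ a / b ⌉ (b = 0 never used)
⌈_/_⌉ : ℕ → ℕ → ℕ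
⌈ a / zero ⌉ = 0
⌈ a / suc b ⌉ = (a + b) / suc b

record SubMultigraph {n : ℕ} (G : Multigraph n) : Set where
  field
    vset  : Subset n
    eset  : List (Edge n)
    esub  : eset ⊆ edges G
    eins  : All (λ e → insideᵇ vset e ≡ true) eset
open SubMultigraph public

-- ω(G) ≤ k  (ω is a maximum over sub-multigraphs with ≥ 2 vertices,
-- so this says every such term is ≤ k)
DensityAtMost : ∀ {n} → Multigraph n → ℕ → Set
DensityAtMost G k = (H : SubMultigraph G) → 2 ≤ ∣ vset H ∣ →
  ⌈ length (eset H) / (∣ vset H ∣ / 2) ⌉ ≤ k

colourClass : ∀ {n c} → (Fin n → Subset c) → Subset n → Fin c → Subset n
colourClass μ S i = tabulate (λ x → lookup S x ∧ lookup (μ x) i)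

-- degree-coloring of G with c colors (colors 1..c represented by Fin c)
record DegreeColoring {n : ℕ} (G : Multigraph n) (c : ℕ) : Set where
  field
    μ        : Fin n → Subset c
    degCond  : ∀ x → ∣ μ x ∣ ≡ deg G x
    coverCond : (S : Subset n) →
      eIn G S ≤ sum (map (λ i → ∣ colourClass μ S i ∣ / 2) (allFin c))

DegColIndexIs : ∀ {n} → Multigraph n → ℕ → Set
DegColIndexIs G t = DegreeColoring G t × (∀ c → DegreeColoring G c → t ≤ c)

-- Giving every vertex the full palette {1..Δ} satisfies the degree condition by
-- regularity, and turns the cover condition into |E(S)| ≤ Δ ⌊|S|/2⌋ for every S.
-- For |S| ≥ 2 this is the density bound applied to the sub-multigraph induced by
-- S; for |S| ≤ 1 it holds because G is loopless, so E(S) is empty. Conversely no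
-- palette with fewer than Δ colours can hold the Δ colours of a single vertex.
module Submission where

open import Defs
open import Data.Nat using (ℕ; suc; _+_; _*_; _≤_; _<_; z≤n; s≤s; _≤?_)
open import Data.Nat.Properties
open import Data.Nat.DivMod using (_/_; _%_; m≡m%n+[m/n]*n; m%n<n; /-monoˡ-≤)
open import Data.Nat.ListAction using (sum)
open import Data.Bool using (Bool; true; T; T?; _∧_)
open import Data.Bool.Properties using (T-≡; T-∧; ∧-identityʳ)
open import Data.Fin using (Fin; zero)
open import Data.Fin.Subset using (Subset; ∣_∣; ⊤; _∈_; _∉_; _-_; ⁅_⁆)
open import Data.Fin.Subset.Properties
  using (∣p∣≤n; ∣⊤∣≡n; x∈p⇒∣p-x∣<∣p∣; x∈p∧x∉q⇒x∈p─q; x∈⁅y⁆⇒x≡y)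
open import Data.Vec using (lookup; tabulate)
open import Data.Vec.Properties using (lookup⇒[]=; lookup-replicate; tabulate-cong; tabulate∘lookup)
open import Data.List using (List; []; _∷_; length; filterᵇ; map; allFin)
open import Data.List.Properties using (map-cong; length-tabulate; filter-none)
open import Data.List.Relation.Unary.All as All using (All)
open import Data.List.Relation.Unary.All.Properties using (all-filter)
open import Data.List.Relation.Binary.Sublist.Propositional.Properties using (filter-⊆)
open import Data.Product using (_,_; proj₁; proj₂)
open import Function using (_∘_; Equivalence)
open import Relation.Nullary using (¬_; yes; no)
open import Relation.Binary.PropositionalEquality

sum-map-const : ∀ {A : Set} (k : ℕ) (xs : List A) → sum (map (λ _ → k) xs) ≡ length xs * k
sum-map-const k []       = refl
sum-map-const k (x ∷ xs) = cong (k +_) (sum-map-const k xs)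

⌈/⌉≤⇒≤* : ∀ a {m k} → 1 ≤ m → ⌈ a / m ⌉ ≤ k → a ≤ k * m
⌈/⌉≤⇒≤* a {suc b} {k} _ ⌈a/b⌉≤k = +-cancelʳ-≤ b a (k * suc b) (begin
  a + b                                       ≡⟨ m≡m%n+[m/n]*n (a + b) (suc b) ⟩
  (a + b) % suc b + (a + b) / suc b * suc b   ≤⟨ +-mono-≤ (≤-pred (m%n<n (a + b) (suc b)))
                                                          (*-monoˡ-≤ (suc b) ⌈a/b⌉≤k) ⟩
  b + k * suc b                               ≡⟨ +-comm b _ ⟩
  k * suc b + b                               ∎)
  where open ≤-Reasoning

all-filterᵇ : ∀ {A : Set} (p : A → Bool) (xs : List A) → All (λ a → p a ≡ true) (filterᵇ p xs)
all-filterᵇ p xs = All.map (Equivalence.to T-≡) (all-filter (T? ∘ p) xs)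

distinct-members⇒2≤∣p∣ : ∀ {n} {p : Subset n} {x y} → x ∈ p → y ∈ p → x ≢ y → 2 ≤ ∣ p ∣
distinct-members⇒2≤∣p∣ {p = p} {x} {y} x∈p y∈p x≢y =
  ≤-trans (s≤s (≤-trans (s≤s z≤n) (x∈p⇒∣p-x∣<∣p∣ y∈p-x))) (x∈p⇒∣p-x∣<∣p∣ x∈p)
  where
  y∉⁅x⁆ : y ∉ ⁅ x ⁆
  y∉⁅x⁆ y∈⁅x⁆ = x≢y (sym (x∈⁅y⁆⇒x≡y x y∈⁅x⁆))
  y∈p-x : y ∈ p - x
  y∈p-x = x∈p∧x∉q⇒x∈p─q y∈p y∉⁅x⁆

inducedSubmultigraph : ∀ {n} (G : Multigraph n) → Subset n → SubMultigraph G
inducedSubmultigraph G S = record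
  { vset = S
  ; eset = filterᵇ (insideᵇ S) (edges G)
  ; esub = filter-⊆ (T? ∘ insideᵇ S) (edges G)
  ; eins = all-filterᵇ (insideᵇ S) (edges G)
  }

eIn≡0 : ∀ {n} (G : Multigraph n) (S : Subset n) → ∣ S ∣ < 2 → eIn G S ≡ 0
eIn≡0 G S ∣S∣<2 =
  cong length (filter-none (T? ∘ insideᵇ S) (All.map edge-not-inside (loopless G)))
  where
  edge-not-inside : ∀ {e} → proj₁ e ≢ proj₂ e → ¬ T (insideᵇ S e)
  edge-not-inside {x , y} x≢y inside with Equivalence.to T-∧ inside
  ... | x∈S , y∈S = <⇒≱ ∣S∣<2 (distinct-members⇒2≤∣p∣
    (lookup⇒[]= x S (Equivalence.to T-≡ x∈S)) (lookup⇒[]= y S (Equivalence.to T-≡ y∈S)) x≢y)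

eIn≤Δ*⌊∣S∣/2⌋ : ∀ {n} (G : Multigraph n) {Δ} → DensityAtMost G Δ → ∀ S → eIn G S ≤ Δ * (∣ S ∣ / 2)
eIn≤Δ*⌊∣S∣/2⌋ G dens S with 2 ≤? ∣ S ∣
... | yes 2≤∣S∣ = ⌈/⌉≤⇒≤* (eIn G S) (/-monoˡ-≤ 2 2≤∣S∣) (dens (inducedSubmultigraph G S) 2≤∣S∣)
... | no  2≰∣S∣ = ≤-trans (≤-reflexive (eIn≡0 G S (≰⇒> 2≰∣S∣))) z≤n

fullPalette : ∀ {n c} → Fin n → Subset c
fullPalette _ = ⊤

colourClass-fullPalette : ∀ {n c} (S : Subset n) (i : Fin c) → colourClass fullPalette S i ≡ S
colourClass-fullPalette S i = begin
  tabulate (λ x → lookup S x ∧ lookup ⊤ i) ≡⟨ tabulate-cong (λ x → cong (lookup S x ∧_) (lookup-replicate i true)) ⟩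
  tabulate (λ x → lookup S x ∧ true)       ≡⟨ tabulate-cong (λ x → ∧-identityʳ (lookup S x)) ⟩
  tabulate (lookup S)                      ≡⟨ tabulate∘lookup S ⟩
  S                                        ∎
  where open ≡-Reasoning

fullPalette-cover : ∀ {n} c (S : Subset n) →
  sum (map (λ i → ∣ colourClass fullPalette S i ∣ / 2) (allFin c)) ≡ c * (∣ S ∣ / 2)
fullPalette-cover c S = begin
  sum (map (λ i → ∣ colourClass fullPalette S i ∣ / 2) (allFin c))
    ≡⟨ cong sum (map-cong (λ i → cong (λ P → ∣ P ∣ / 2) (colourClass-fullPalette S i)) (allFin c)) ⟩
  sum (map (λ _ → ∣ S ∣ / 2) (allFin c))  ≡⟨ sum-map-const (∣ S ∣ / 2) (allFin c) ⟩
  length (allFin c) * (∣ S ∣ / 2)          ≡⟨ cong (_* (∣ S ∣ / 2)) (length-tabulate {n = c} (λ i → i)) ⟩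
  c * (∣ S ∣ / 2)                          ∎
  where open ≡-Reasoning

fullPaletteColoring : ∀ {n} (G : Multigraph n) {Δ} → Regular G Δ →
  (∀ S → eIn G S ≤ Δ * (∣ S ∣ / 2)) → DegreeColoring G Δ
fullPaletteColoring G {Δ} regular eIn≤ = record
  { μ         = fullPalette
  ; degCond   = λ x → trans (∣⊤∣≡n Δ) (sym (regular x))
  ; coverCond = λ S → subst (eIn G S ≤_) (sym (fullPalette-cover Δ S)) (eIn≤ S)
  }

deg≤colours : ∀ {n c} {G : Multigraph n} → DegreeColoring G c → ∀ x → deg G x ≤ c
deg≤colours D x = subst (_≤ _) (degCond x) (∣p∣≤n (μ x))
  where open DegreeColoring D

mainTheorem2 : (n : ℕ) (G : Multigraph (suc n)) (Δ : ℕ) →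
    Regular G Δ → DensityAtMost G Δ → DegColIndexIs G Δ
mainTheorem2 n G Δ regular dens =
    fullPaletteColoring G regular (eIn≤Δ*⌊∣S∣/2⌋ G dens)
  , λ c D → subst (_≤ c) (regular zero) (deg≤colours D zero)
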